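{- Let $p,q$ be integers with $\Delta=p^2-4q\neq 0$. The generating function $g^{(2)}(x)=\sum_{n=0}^{\infty}U_n^{(2)}x^n$ (as a formal power series) satisfies $$g^{(2)}(x)=\frac{x^{2}}{1-px+pqx^{3}-q^{2}x^{4}}.$$
   Context: For integers $p,q$, $(U_n)_{n\geq0}$ is defined by $U_0=0$, $U_1=1$, $U_n=pU_{n-1}-qU_{n-2}$ ($n\geq2$). With $\alpha=\frac{p+\sqrt{\Delta}}{2}$, $\beta=\frac{p-\sqrt{\Delta}}{2}$, for $n=2m+r$ with $m\geq0$, $r\in\{0,1\}$, define $U_n^{(2)}=\frac{1}{(\alpha-\beta)^2}(\alpha^{m+1}-\beta^{m+1})^{r}(\alpha^{m}-\beta^{m})^{2-r}$; equivalently $U_{2m}^{(2)}=U_m^2$ and $U_{2m+1}^{(2)}=U_mU_{m+1}$. -}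

module Defs where

open import Data.Nat as ℕ using (ℕ; zero; suc; _/_; _%_)
open import Data.Integer using (ℤ; +_; -_; _+_; _*_; _-_)

U : ℤ → ℤ → ℕ → ℤ
U p q zero = + 0
U p q (suc zero) = + 1
U p q (suc (suc n)) = p * U p q (suc n) - q * U p q n

U2 : ℤ → ℤ → ℕ → ℤ
U2 p q n with n % 2
... | zero  = U p q (n / 2) * U p q (n / 2)
... | suc _ = U p q (n / 2) * U p q (suc (n / 2))

FPS : Set
FPS = ℕ → ℤ

sumTo : ℕ → (ℕ → ℤ) → ℤ
sumTo zero f = f zero
sumTo (suc n) f = sumTo n f + f (suc n)

_⊛_ : FPS → FPS → FPS
(a ⊛ b) n = sumTo n (λ i → a i * b (n ℕ.∸ i))

g2 : ℤ → ℤ → FPS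
g2 p q = U2 p q

denom : ℤ → ℤ → FPS
denom p q zero = + 1
denom p q (suc zero) = - p
denom p q (suc (suc zero)) = + 0
denom p q (suc (suc (suc zero))) = p * q
denom p q (suc (suc (suc (suc zero)))) = - (q * q)
denom p q (suc (suc (suc (suc (suc _))))) = + 0

x² : FPS
x² (suc (suc zero)) = + 1
x² _ = + 0

-- The sequence U⁽²⁾ satisfies the fourth-order recurrence
--   U⁽²⁾(n+4) = p U⁽²⁾(n+3) − p q U⁽²⁾(n+1) + q² U⁽²⁾(n),
-- checked separately for even and odd n from U(m+2) = p U(m+1) − q U(m).
-- Its characteristic polynomial is the reversal of 1 − p x + p q x³ − q² x⁴,
-- so the product of g⁽²⁾ with that polynomial has no coefficient beyond x³,
-- and the first four coefficients are 0, 0, 1, 0.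
module Submission where

open import Data.Nat as ℕ using (ℕ; zero; suc; _<_; _≤_; _∸_; s≤s; z≤n)
import Data.Nat.Properties as ℕ
open import Data.Nat.DivMod using (m*n%n≡0; m*n/n≡m; [m+kn]%n≡m%n; +-distrib-/-∣ʳ)
open import Data.Nat.Divisibility using (divides-refl)
open import Data.Integer using (ℤ; +_; -_; _+_; _*_; _-_)
open import Data.Integer.Properties using (+-identityˡ; *-zeroʳ)
open import Data.Integer.Tactic.RingSolver using (solve-∀; solve)
open import Data.List using (_∷_; [])
open import Relation.Binary.PropositionalEquality
open ≡-Reasoning

open import Defs

sumTo-cong : ∀ n {f g : ℕ → ℤ} → (∀ i → f i ≡ g i) → sumTo n f ≡ sumTo n g
sumTo-cong zero    f≗g = f≗g 0
sumTo-cong (suc n) f≗g = cong₂ _+_ (sumTo-cong n f≗g) (f≗g (suc n))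

sumTo-zero : ∀ n {f : ℕ → ℤ} → (∀ i → i ≤ n → f i ≡ + 0) → sumTo n f ≡ + 0
sumTo-zero zero    f≡0 = f≡0 0 z≤n
sumTo-zero (suc n) f≡0 =
  cong₂ _+_ (sumTo-zero n (λ i i≤n → f≡0 i (ℕ.m≤n⇒m≤1+n i≤n))) (f≡0 (suc n) ℕ.≤-refl)

sumTo-dropZeros : ∀ w k {f : ℕ → ℤ} → (∀ i → i < k → f i ≡ + 0) →
                  sumTo (w ℕ.+ k) f ≡ sumTo w (λ j → f (j ℕ.+ k))
sumTo-dropZeros zero    zero    _   = refl
sumTo-dropZeros zero    (suc k) {f} f≡0 = begin
  sumTo k f + f (suc k) ≡⟨ cong (_+ f (suc k)) (sumTo-zero k (λ i i≤k → f≡0 i (s≤s i≤k))) ⟩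
  + 0 + f (suc k)       ≡⟨ +-identityˡ (f (suc k)) ⟩
  f (suc k)             ∎
sumTo-dropZeros (suc w) k {f} f≡0 = cong (_+ f (suc (w ℕ.+ k))) (sumTo-dropZeros w k f≡0)

DegreeAtMost : ℕ → FPS → Set
DegreeAtMost w d = ∀ i → w < i → d i ≡ + 0

[m+o]∸[n+o]≡m∸n : ∀ m n o → (m ℕ.+ o) ∸ (n ℕ.+ o) ≡ m ∸ n
[m+o]∸[n+o]≡m∸n m n o = trans (cong₂ _∸_ (ℕ.+-comm m o) (ℕ.+-comm n o)) (ℕ.[m+n]∸[m+o]≡n∸o o m n)

⊛-degreeAtMost : ∀ w (a d : FPS) → DegreeAtMost w d →
                 ∀ k → (a ⊛ d) (w ℕ.+ k) ≡ sumTo w (λ j → a (j ℕ.+ k) * d (w ∸ j))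
⊛-degreeAtMost w a d deg k = begin
  sumTo (w ℕ.+ k) (λ i → a i * d (w ℕ.+ k ∸ i))
    ≡⟨ sumTo-dropZeros w k (λ i i<k → trans (cong (a i *_) (deg _ (w<w+k∸i i<k))) (*-zeroʳ (a i))) ⟩
  sumTo w (λ j → a (j ℕ.+ k) * d (w ℕ.+ k ∸ (j ℕ.+ k)))
    ≡⟨ sumTo-cong w (λ j → cong (λ m → a (j ℕ.+ k) * d m) ([m+o]∸[n+o]≡m∸n w j k)) ⟩
  sumTo w (λ j → a (j ℕ.+ k) * d (w ∸ j)) ∎
  where
  w<w+k∸i : ∀ {i} → i < k → w < w ℕ.+ k ∸ i
  w<w+k∸i i<k = subst (w <_) (sym (ℕ.+-∸-assoc w (ℕ.<⇒≤ i<k))) (ℕ.m<m+n w (ℕ.m<n⇒0<n∸m i<k))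

denom-degree : ∀ p q → DegreeAtMost 4 (denom p q)
denom-degree p q (suc (suc (suc (suc (suc i))))) _ = refl
denom-degree p q 0 ()
denom-degree p q 1 (s≤s ())
denom-degree p q 2 (s≤s (s≤s ()))
denom-degree p q 3 (s≤s (s≤s (s≤s ())))
denom-degree p q 4 (s≤s (s≤s (s≤s (s≤s ()))))

denom-annihilates : ∀ p q (a : FPS) →
  (∀ k → a (4 ℕ.+ k) ≡ p * a (3 ℕ.+ k) - p * q * a (1 ℕ.+ k) + q * q * a k) →
  ∀ k → (a ⊛ denom p q) (4 ℕ.+ k) ≡ + 0
denom-annihilates p q a rec k = begin
  (a ⊛ denom p q) (4 ℕ.+ k)
    ≡⟨ ⊛-degreeAtMost 4 a (denom p q) (denom-degree p q) k ⟩
  a₀ * - (q * q) + a₁ * (p * q) + a₂ * + 0 + a₃ * - p + a (4 ℕ.+ k) * + 1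
    ≡⟨ cong (λ a₄ → a₀ * - (q * q) + a₁ * (p * q) + a₂ * + 0 + a₃ * - p + a₄ * + 1) (rec k) ⟩
  a₀ * - (q * q) + a₁ * (p * q) + a₂ * + 0 + a₃ * - p + (p * a₃ - p * q * a₁ + q * q * a₀) * + 1
    ≡⟨ cancel p q a₀ a₁ a₂ a₃ ⟩
  + 0 ∎
  where
  cancel : ∀ p q a₀ a₁ a₂ a₃ →
    a₀ * - (q * q) + a₁ * (p * q) + a₂ * + 0 + a₃ * - p + (p * a₃ - p * q * a₁ + q * q * a₀) * + 1 ≡ + 0
  cancel = solve-∀
  a₀ = a k
  a₁ = a (1 ℕ.+ k)
  a₂ = a (2 ℕ.+ k)
  a₃ = a (3 ℕ.+ k)

data EvenOdd : ℕ → Set where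
  even : ∀ m → EvenOdd (m ℕ.* 2)
  odd  : ∀ m → EvenOdd (suc (m ℕ.* 2))

evenOdd : ∀ n → EvenOdd n
evenOdd zero = even 0
evenOdd (suc n) with evenOdd n
... | even m = odd m
... | odd m  = even (suc m)

[1+m*2]/2≡m : ∀ m → suc (m ℕ.* 2) ℕ./ 2 ≡ m
[1+m*2]/2≡m m = trans (+-distrib-/-∣ʳ 1 {d = 2} (divides-refl m)) (m*n/n≡m m 2)

-- For consecutive Lucas terms a, b: the recurrence of U⁽²⁾ at even and at odd indices.
square-step : ∀ p q a b → let c = p * b - q * a in
  c * c ≡ p * (b * c) - p * q * (a * b) + q * q * (a * a)
square-step = solve-∀

product-step : ∀ p q a b → let c = p * b - q * a in
  c * (p * c - q * b) ≡ p * (c * c) - p * q * (b * b) + q * q * (a * b)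
product-step = solve-∀

module _ (p q : ℤ) where

  U2-even : ∀ m → U2 p q (m ℕ.* 2) ≡ U p q m * U p q m
  U2-even m rewrite m*n%n≡0 m 2 ⦃ _ ⦄ | m*n/n≡m m 2 ⦃ _ ⦄ = refl

  U2-odd : ∀ m → U2 p q (suc (m ℕ.* 2)) ≡ U p q m * U p q (suc m)
  U2-odd m rewrite [m+kn]%n≡m%n 1 m 2 ⦃ _ ⦄ | [1+m*2]/2≡m m = refl

  U2-recurrence : ∀ k →
    U2 p q (4 ℕ.+ k) ≡ p * U2 p q (3 ℕ.+ k) - p * q * U2 p q (1 ℕ.+ k) + q * q * U2 p q k
  U2-recurrence k with evenOdd k
  ... | even m rewrite U2-even (2 ℕ.+ m) | U2-odd (1 ℕ.+ m) | U2-odd m | U2-even m =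
    square-step p q (U p q m) (U p q (suc m))
  ... | odd m rewrite U2-odd (2 ℕ.+ m) | U2-even (2 ℕ.+ m) | U2-even (1 ℕ.+ m) | U2-odd m =
    product-step p q (U p q m) (U p q (suc m))

theorem5 : (p q : ℤ) → p * p - (+ 4) * q ≢ + 0 →
    ∀ (n : ℕ) → (g2 p q ⊛ denom p q) n ≡ x² n
theorem5 p q _ 0 = refl
theorem5 p q _ 1 = refl
theorem5 p q _ 2 = refl
theorem5 p q _ 3 = begin
  (g2 p q ⊛ denom p q) 3                                                  ≡⟨⟩
  U2 p q 0 * (p * q) + U2 p q 1 * + 0 + U2 p q 2 * - p + U2 p q 3 * + 1  ≡⟨⟩
  + 0 * + 0 * (p * q) + + 0 * + 1 * + 0 + + 1 * + 1 * - p + + 1 * (p * + 1 - q * + 0) * + 1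
    ≡⟨ solve (p ∷ q ∷ []) ⟩
  + 0 ∎
theorem5 p q _ (suc (suc (suc (suc k)))) = denom-annihilates p q (g2 p q) (U2-recurrence p q) k
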